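{- Let $A$ be an abelian group (written additively), $\alpha$ an automorphism of $A$ and $s\in A$, such that $S=\{\alpha^i(s):i\in\mathbf Z\}$ is a generating set of $A$ with $0\notin S$ and $S=-S$. Let $\mathcal M$ be the Cayley map for $A$ with respect to $S$ in which the rotation at each vertex $a$ sends the neighbour $a+\alpha^i(s)$ to $a+\alpha^{i+1}(s)$. Then all faces of $\mathcal M$ have the same valency $m$ and all Petrie polygons have the same length $l$, and: (a) if the automorphism $-\alpha:a\mapsto-\alpha(a)$ of $A$ fixes only $0$, then $m$ is the order of $-\alpha$; (b) $l$ is twice the order of the element $\alpha(s)-s$ in $A$.
   Context: A Cayley map for a group $A$ with respect to a generating set $S$ (with $0\notin S=-S$) is the embedding of the Cayley graph (vertices $A$, $a$ adjacent to $a+s$ for $s\in S$) in a compact oriented surface determined by a rotation system, i.e. a cyclic ordering of the neighbours of each vertex given by the local orientation; faces are traced by following the rotation. The valency of a face is the number of edges on its boundary. A Petrie polygon is a closed zig-zag path, turning alternately to the first edge on the left and the first edge on the right at successive vertices; its length is its number of edges. -}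

module Defs where

open import Level using (_⊔_)
open import Algebra.Bundles using (AbelianGroup)
open import Data.Nat using (ℕ; zero; suc; _<_; _*_)
open import Data.Nat.Divisibility using (_∣_)
open import Data.Integer using (ℤ; +_; -[1+_])
open import Data.List using (List; []; _∷_; foldr)
open import Data.List.Relation.Unary.All using (All)
open import Data.List.Relation.Unary.Any using (Any)
open import Data.Product using (Σ; _×_; _,_; ∃)
open import Data.Sum using (_⊎_)
open import Relation.Nullary using (¬_)

iter : ∀ {a} {X : Set a} → (X → X) → ℕ → X → X
iter f zero x = x
iter f (suc n) x = f (iter f n x)

module _ {c ℓ} (G : AbelianGroup c ℓ) where
  open AbelianGroup G renaming (Carrier to A)

  Finite : Set (c ⊔ ℓ)
  Finite = Σ (List A) λ xs → ∀ x → Any (x ≈_) xs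

  record Automorphism : Set (c ⊔ ℓ) where
    field
      fun     : A → A
      inv     : A → A
      fun-cong : ∀ {x y} → x ≈ y → fun x ≈ fun y
      inv-cong : ∀ {x y} → x ≈ y → inv x ≈ inv y
      fun-hom : ∀ x y → fun (x ∙ y) ≈ fun x ∙ fun y
      fun-inv : ∀ x → fun (inv x) ≈ x
      inv-fun : ∀ x → inv (fun x) ≈ x

  module _ (α : Automorphism) where
    open Automorphism α

    powℤ : ℤ → A → A
    powℤ (+ n) = iter fun n
    powℤ -[1+ n ] = iter inv (suc n)

    InS : A → A → Set ℓ
    InS s x = ∃ λ (i : ℤ) → x ≈ powℤ i s

  sumG : List A → A
  sumG = foldr _∙_ ε

  Generates : (A → Set ℓ) → Set (c ⊔ ℓ)
  Generates P = ∀ a → Σ (List A) λ xs → All (λ x → P x ⊎ P (x ⁻¹)) xs × sumG xs ≈ a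

  mulℕ : ℕ → A → A
  mulℕ n x = iter (x ∙_) n ε

  ElemOrder : A → ℕ → Set ℓ
  ElemOrder x k = 0 < k × mulℕ k x ≈ ε × (∀ j → 0 < j → j < k → ¬ (mulℕ j x ≈ ε))

  MapOrder : (A → A) → ℕ → Set (c ⊔ ℓ)
  MapOrder φ k = 0 < k × (∀ a → iter φ k a ≈ a)
               × (∀ j → 0 < j → j < k → ¬ (∀ a → iter φ j a ≈ a))

  -- The Cayley map.  A dart (a , x) is the arc from a to a + x (x ∈ S).
  Dart : Set c
  Dart = A × A

  _≈D_ : Dart → Dart → Set ℓ
  (a , x) ≈D (b , y) = a ≈ b × x ≈ y

  module _ (α : Automorphism) where
    open Automorphism α

    rot : Dart → Dart
    rot (a , x) = (a , fun x)

    rot⁻¹ : Dart → Dart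
    rot⁻¹ (a , x) = (a , inv x)

    rev : Dart → Dart
    rev (a , x) = (a ∙ x , x ⁻¹)

    faceStep : Dart → Dart
    faceStep d = rot (rev d)

    FaceValency : Dart → ℕ → Set ℓ
    FaceValency d m = 0 < m × iter faceStep m d ≈D d
                    × (∀ j → 0 < j → j < m → ¬ (iter faceStep j d ≈D d))

    -- zig-zag walks: turn to first edge on the left (rot) / right (rot⁻¹) alternately
    zigzagL zigzagR : Dart → ℕ → Dart
    zigzagL d zero = d
    zigzagL d (suc n) = zigzagR (rot (rev d)) n
    zigzagR d zero = d
    zigzagR d (suc n) = zigzagL (rot⁻¹ (rev d)) n

    -- the zig-zag walk W starting at d closes up (same dart, same turning phase)
    -- for the first time after l edges
    PetrieLength : (Dart → ℕ → Dart) → Dart → ℕ → Set ℓ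
    PetrieLength W d l = 0 < l × 2 ∣ l × W d l ≈D d
                       × (∀ j → 0 < j → j < l → 2 ∣ j → ¬ (W d j ≈D d))

-- The face-tracing map sends a dart (b , y) to (b + y , β y) with β = −α, so after n steps
-- it sits at (b + σₙ y , βⁿ y) where σₙ y = y + β y + ⋯ + βⁿ⁻¹ y; two zig-zag steps
-- translate a dart (b , y) by y − α y (left first) or y − α⁻¹ y (right first).  Every
-- y ∈ S is ψ s for ψ = αⁱ, an injective endomorphism commuting with α, and such ψ preserve
-- and reflect the closing conditions σₙ y = 0, βⁿ y = y and q (y − α y) = 0 = q (y − α⁻¹ y).
-- Hence all faces have the valency m of the face through (0 , s), and all Petrie polygons
-- have length 2k where k is the order of α s − s.  If β fixes only 0, then βᵐ fixes s,
-- hence S, hence A; and βʲ = id forces β (σⱼ s) = σⱼ s, i.e. σⱼ s = 0, so the face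
-- already closes after j steps.
module Submission where

open import Defs
open import Level using (_⊔_)
open import Algebra.Bundles using (AbelianGroup)
open import Algebra.Morphism.Structures using (IsMagmaHomomorphism; IsMagmaMonomorphism)
open import Algebra.Morphism.Consequences using (homomorphic₂-inj)
import Algebra.Morphism.Construct.Composition as Composition
import Algebra.Morphism.Construct.Identity as Identity
open import Data.Fin using (Fin; toℕ; combine)
open import Data.Fin.Properties using (pigeonhole; combine-injective)
open import Data.Integer using (+_; -[1+_])
open import Data.List using (length; lookup)
import Data.List.Relation.Unary.Any as Any
open import Data.List.Relation.Unary.Any.Properties using (lookup-index)
open import Data.List.Relation.Unary.All using (All; []; _∷_)
open import Data.Nat using (ℕ; zero; suc; _+_; _*_; _∸_; _<_; _≤_; z<s; s≤s⁻¹)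
open import Data.Nat.Properties
  using (n<1+n; m<n⇒0<n∸m; m+[n∸m]≡n; <⇒≤; ≤-refl; m≤n⇒m<n∨m≡n; *-comm; *-cancelʳ-<)
open import Data.Nat.Divisibility using (divides)
open import Data.Product using (Σ; _×_; _,_; ∃; proj₁; proj₂)
open import Data.Sum using (_⊎_; inj₁; inj₂; [_,_])
open import Function using (_∘_; _⇔_; mk⇔; Equivalence)
open import Function.Definitions using (Injective)
import Function.Properties.Equivalence as ⇔
open import Relation.Binary.Core using (Rel)
open import Relation.Binary.Definitions using (Decidable; Symmetric; Transitive)
import Relation.Binary.PropositionalEquality as ≡
open import Relation.Binary.PropositionalEquality using (_≡_)
open import Relation.Nullary using (¬_; Dec; yes; no; contradiction)
open import Relation.Nullary.Decidable using (_×-dec_)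

LeastPositive : ∀ {p} → (ℕ → Set p) → ℕ → Set p
LeastPositive Q m = 0 < m × Q m × (∀ j → 0 < j → j < m → ¬ Q j)

LeastPositive-⇔ : ∀ {p q} {P : ℕ → Set p} {Q : ℕ → Set q} →
                  (∀ n → P n ⇔ Q n) → ∀ {m} → LeastPositive P m → LeastPositive Q m
LeastPositive-⇔ P⇔Q (0<m , Pm , below) =
  0<m , Equivalence.to (P⇔Q _) Pm , λ j 0<j j<m → below j 0<j j<m ∘ Equivalence.from (P⇔Q j)

module _ {p} {Q : ℕ → Set p} (Q? : ∀ n → Dec (Q n)) where

  noneUpTo⊎leastPositive : ∀ n → (∀ j → 0 < j → j ≤ n → ¬ Q j) ⊎ ∃ (LeastPositive Q)
  noneUpTo⊎leastPositive zero = inj₁ λ { zero () ; (suc j) _ () }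
  noneUpTo⊎leastPositive (suc n) with noneUpTo⊎leastPositive n | Q? (suc n)
  ... | inj₂ least | _     = inj₂ least
  ... | inj₁ none  | yes q = inj₂ (suc n , z<s , q , λ j 0<j j<1+n → none j 0<j (s≤s⁻¹ j<1+n))
  ... | inj₁ none  | no ¬q = inj₁ λ j 0<j j≤1+n →
    [ none j 0<j ∘ s≤s⁻¹ , (λ { ≡.refl → ¬q }) ] (m≤n⇒m<n∨m≡n j≤1+n)

  leastPositive : ∀ {n} → 0 < n → Q n → ∃ (LeastPositive Q)
  leastPositive {n} 0<n q =
    [ (λ none → contradiction q (none n 0<n ≤-refl)) , (λ least → least) ]
    (noneUpTo⊎leastPositive n)

FinitelyCoded : ∀ {a ℓ} {D : Set a} → Rel D ℓ → Set (a ⊔ ℓ)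
FinitelyCoded {D = D} _≈_ = ∃ λ K → Σ (D → Fin K) (Injective _≈_ _≡_)

module _ {a ℓ} {D : Set a} {_≈_ : Rel D ℓ} (≈-sym : Symmetric _≈_)
         {f : D → D} (f-injective : Injective _≈_ _≈_ f) where

  iter-cancelˡ : ∀ i k d → iter f (i + k) d ≈ iter f i d → iter f k d ≈ d
  iter-cancelˡ zero    k d eq = eq
  iter-cancelˡ (suc i) k d eq = iter-cancelˡ i k d (f-injective eq)

  iter-periodic : FinitelyCoded _≈_ → ∀ d → ∃ λ n → 0 < n × iter f n d ≈ d
  iter-periodic (K , code , code-injective) d
    with pigeonhole (n<1+n K) (λ i → code (iter f (toℕ i) d))
  ... | i , j , i<j , sameCode = toℕ j ∸ toℕ i , m<n⇒0<n∸m i<j ,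
    iter-cancelˡ (toℕ i) _ d
      (≡.subst (λ t → iter f t d ≈ iter f (toℕ i) d) (≡.sym (m+[n∸m]≡n (<⇒≤ i<j)))
               (≈-sym (code-injective sameCode)))

  leastPeriod : FinitelyCoded _≈_ → Decidable _≈_ → ∀ d →
                ∃ (LeastPositive λ n → iter f n d ≈ d)
  leastPeriod coded _≟_ d with iter-periodic coded d
  ... | n , 0<n , periodic = leastPositive (λ n → iter f n d ≟ d) 0<n periodic

module _ {c ℓ} (G : AbelianGroup c ℓ) where
  open AbelianGroup G renaming (Carrier to A)
  open import Algebra.Properties.AbelianGroup G
  open import Relation.Binary.Reasoning.Setoid setoid

  infix 4 _≈ᴰ_
  _≈ᴰ_ : Rel (Dart G) ℓ
  _≈ᴰ_ = _≈D_ G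

  Finite⇒FinitelyCoded : Finite G → FinitelyCoded _≈_
  Finite⇒FinitelyCoded (xs , complete) = length xs , index , index-injective
    where
    index : A → Fin (length xs)
    index x = Any.index (complete x)

    index-injective : Injective _≈_ _≡_ index
    index-injective {x} {y} sameIndex = begin
      x                      ≈⟨ lookup-index (complete x) ⟩
      lookup xs (index x)    ≡⟨ ≡.cong (lookup xs) sameIndex ⟩
      lookup xs (index y)    ≈⟨ lookup-index (complete y) ⟨
      y                      ∎

  Finite⇒DartsFinitelyCoded : Finite G → FinitelyCoded _≈ᴰ_
  Finite⇒DartsFinitelyCoded fin with Finite⇒FinitelyCoded fin
  ... | K , code , code-injective =
    K * K , (λ (a , x) → combine (code a) (code x)) ,
    λ {(a , x)} {(b , y)} sameCode →
      let ab , xy = combine-injective (code a) (code x) (code b) (code y) sameCode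
      in code-injective ab , code-injective xy

  module Endomorphism {ψ : A → A} (ψ-homo : IsMagmaHomomorphism rawMagma rawMagma ψ) where
    open IsMagmaHomomorphism ψ-homo public

    ε-homo : ψ ε ≈ ε
    ε-homo = identityʳ-unique (ψ ε) (ψ ε) (trans (sym (homo ε ε)) (⟦⟧-cong (identityʳ ε)))

    ⁻¹-homo : ∀ x → ψ (x ⁻¹) ≈ ψ x ⁻¹
    ⁻¹-homo x = inverseʳ-unique (ψ x) (ψ (x ⁻¹))
      (trans (sym (homo x (x ⁻¹))) (trans (⟦⟧-cong (inverseʳ x)) ε-homo))

    mulℕ-homo : ∀ n x → ψ (mulℕ G n x) ≈ mulℕ G n (ψ x)
    mulℕ-homo zero    x = ε-homo
    mulℕ-homo (suc n) x = trans (homo x (mulℕ G n x)) (∙-congˡ (mulℕ-homo n x))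

    fixes-generated : ∀ {P} → Generates G P → (∀ x → P x → ψ x ≈ x) → ∀ a → ψ a ≈ a
    fixes-generated {P} generates fixes a with generates a
    ... | xs , generators , sum≈a =
      trans (⟦⟧-cong (sym sum≈a)) (trans (fixes-sum generators) sum≈a)
      where
      fixes-± : ∀ {x} → P x ⊎ P (x ⁻¹) → ψ x ≈ x
      fixes-± {x} (inj₁ Px)  = fixes x Px
      fixes-± {x} (inj₂ P-x) = begin
        ψ x            ≈⟨ ⟦⟧-cong (⁻¹-involutive x) ⟨
        ψ (x ⁻¹ ⁻¹)    ≈⟨ ⁻¹-homo (x ⁻¹) ⟩
        ψ (x ⁻¹) ⁻¹    ≈⟨ ⁻¹-cong (fixes (x ⁻¹) P-x) ⟩
        x ⁻¹ ⁻¹        ≈⟨ ⁻¹-involutive x ⟩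
        x              ∎

      fixes-sum : ∀ {ys} → All (λ y → P y ⊎ P (y ⁻¹)) ys → ψ (sumG G ys) ≈ sumG G ys
      fixes-sum []       = ε-homo
      fixes-sum (p ∷ ps) = trans (homo _ _) (∙-cong (fixes-± p) (fixes-sum ps))

  ⟦⟧≈ε⇔≈ε : ∀ {ψ} → IsMagmaMonomorphism rawMagma rawMagma ψ → ∀ {x} → ψ x ≈ ε ⇔ x ≈ ε
  ⟦⟧≈ε⇔≈ε ψ-mono = mk⇔ (λ ψx≈ε → injective (trans ψx≈ε (sym ε-homo)))
                        (λ x≈ε → trans (⟦⟧-cong x≈ε) ε-homo)
    where
    open IsMagmaMonomorphism ψ-mono using (injective)
    open Endomorphism (IsMagmaMonomorphism.isMagmaHomomorphism ψ-mono)

  mulℕ-cong : ∀ n {x y} → x ≈ y → mulℕ G n x ≈ mulℕ G n y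
  mulℕ-cong zero    x≈y = refl
  mulℕ-cong (suc n) x≈y = ∙-cong x≈y (mulℕ-cong n x≈y)

  mulℕ≈ε-transport : ∀ {χ} → IsMagmaMonomorphism rawMagma rawMagma χ → ∀ q {x y} → x ≈ χ y →
                     mulℕ G q x ≈ ε ⇔ mulℕ G q y ≈ ε
  mulℕ≈ε-transport {χ} χ-mono q {x} {y} x≈χy =
    ⇔.trans (mk⇔ (trans χqy≈qx) (trans (sym χqy≈qx))) (⟦⟧≈ε⇔≈ε χ-mono)
    where
    χqy≈qx : χ (mulℕ G q y) ≈ mulℕ G q x
    χqy≈qx = trans (mulℕ-homo q y) (mulℕ-cong q (sym x≈χy))
      where open Endomorphism (IsMagmaMonomorphism.isMagmaHomomorphism χ-mono)

  ≈ᴰ-sym : Symmetric _≈ᴰ_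
  ≈ᴰ-sym (a≈b , x≈y) = sym a≈b , sym x≈y

  ≈ᴰ-trans : Transitive _≈ᴰ_
  ≈ᴰ-trans (a≈b , x≈y) (b≈c , y≈z) = trans a≈b b≈c , trans x≈y y≈z

  ≈ᴰ-dec : Decidable _≈_ → Decidable _≈ᴰ_
  ≈ᴰ-dec _≟_ (a , x) (b , y) = (a ≟ b) ×-dec (x ≟ y)

  translation-closes⇔ : ∀ {d b y z} → d ≈ᴰ (b ∙ z , y) → d ≈ᴰ (b , y) ⇔ z ≈ ε
  translation-closes⇔ {b = b} (b′≈ , y′≈) = mk⇔
    (λ (b′≈b , _) → identityʳ-unique b _ (trans (sym b′≈) b′≈b))
    (λ z≈ε → trans b′≈ (trans (∙-congˡ z≈ε) (identityʳ b)) , y′≈)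

  module _ (α : Automorphism G) where
    open Automorphism α

    record IsEquivariantMono (ψ : A → A) : Set (c ⊔ ℓ) where
      field
        isMagmaMonomorphism : IsMagmaMonomorphism rawMagma rawMagma ψ
        commute             : ∀ x → ψ (fun x) ≈ fun (ψ x)

      open IsMagmaMonomorphism isMagmaMonomorphism public using (injective; isMagmaHomomorphism)
      open Endomorphism isMagmaHomomorphism public

      commute-inv : ∀ x → ψ (inv x) ≈ inv (ψ x)
      commute-inv x = begin
        ψ (inv x)               ≈⟨ inv-fun (ψ (inv x)) ⟨
        inv (fun (ψ (inv x)))   ≈⟨ inv-cong (commute (inv x)) ⟨
        inv (ψ (fun (inv x)))   ≈⟨ inv-cong (⟦⟧-cong (fun-inv x)) ⟩
        inv (ψ x)               ∎

    open IsEquivariantMono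

    id-mono : IsEquivariantMono (λ x → x)
    id-mono = record
      { isMagmaMonomorphism = Identity.isMagmaMonomorphism rawMagma refl
      ; commute             = λ _ → refl
      }

    ∘-mono : ∀ {ψ χ} → IsEquivariantMono ψ → IsEquivariantMono χ → IsEquivariantMono (ψ ∘ χ)
    ∘-mono {ψ} {χ} ψ-mono χ-mono = record
      { isMagmaMonomorphism =
          Composition.isMagmaMonomorphism trans
            (isMagmaMonomorphism χ-mono) (isMagmaMonomorphism ψ-mono)
      ; commute = λ x → trans (⟦⟧-cong ψ-mono (commute χ-mono x)) (commute ψ-mono (χ x))
      }

    iter-mono : ∀ {ψ} → IsEquivariantMono ψ → ∀ n → IsEquivariantMono (iter ψ n)
    iter-mono ψ-mono zero    = id-mono
    iter-mono ψ-mono (suc n) = ∘-mono ψ-mono (iter-mono ψ-mono n)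

    fun-injective : Injective _≈_ _≈_ fun
    fun-injective {x} {y} fx≈fy = trans (sym (inv-fun x)) (trans (inv-cong fx≈fy) (inv-fun y))

    fun-mono : IsEquivariantMono fun
    fun-mono = record
      { isMagmaMonomorphism = record
        { isMagmaHomomorphism = record
          { isRelHomomorphism = record { cong = fun-cong }
          ; homo              = fun-hom
          }
        ; injective           = fun-injective
        }
      ; commute = λ _ → refl
      }

    inv-mono : IsEquivariantMono inv
    inv-mono = record
      { isMagmaMonomorphism = record
        { isMagmaHomomorphism = record
          { isRelHomomorphism = record { cong = inv-cong }
          ; homo = homomorphic₂-inj magma magma fun-injective
                     (λ {x} y≈inv-x → trans (fun-cong y≈inv-x) (fun-inv x)) fun-hom
          }
        ; injective = λ {x} {y} ix≈iy →
            trans (sym (fun-inv x)) (trans (fun-cong ix≈iy) (fun-inv y))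
        }
      ; commute = λ x → trans (inv-fun x) (sym (fun-inv x))
      }

    ⁻¹-mono : IsEquivariantMono _⁻¹
    ⁻¹-mono = record
      { isMagmaMonomorphism = record
        { isMagmaHomomorphism = record
          { isRelHomomorphism = record { cong = ⁻¹-cong }
          ; homo = λ x y → sym (⁻¹-∙-comm x y)
          }
        ; injective = ⁻¹-injective
        }
      ; commute = λ x → sym (⁻¹-homo fun-mono x)
      }

    powℤ-mono : ∀ i → IsEquivariantMono (powℤ G α i)
    powℤ-mono (+ n)    = iter-mono fun-mono n
    powℤ-mono -[1+ n ] = iter-mono inv-mono (suc n)

    β : A → A
    β a = fun a ⁻¹

    β-mono : IsEquivariantMono β
    β-mono = ∘-mono ⁻¹-mono fun-mono

    iter-β-commute : ∀ {ψ} → IsEquivariantMono ψ → ∀ n x → ψ (iter β n x) ≈ iter β n (ψ x)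
    iter-β-commute ψ-mono zero    x = refl
    iter-β-commute {ψ} ψ-mono (suc n) x = begin
      ψ (β (iter β n x))       ≈⟨ ⁻¹-homo ψ-mono (fun (iter β n x)) ⟩
      ψ (fun (iter β n x)) ⁻¹  ≈⟨ ⁻¹-cong (commute ψ-mono (iter β n x)) ⟩
      β (ψ (iter β n x))       ≈⟨ ⟦⟧-cong β-mono (iter-β-commute ψ-mono n x) ⟩
      β (iter β n (ψ x))       ∎

    βsum : ℕ → A → A
    βsum zero    y = ε
    βsum (suc n) y = βsum n y ∙ iter β n y

    βsum-cong : ∀ n {x y} → x ≈ y → βsum n x ≈ βsum n y
    βsum-cong zero    x≈y = refl
    βsum-cong (suc n) x≈y = ∙-cong (βsum-cong n x≈y) (⟦⟧-cong (iter-mono β-mono n) x≈y)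

    βsum-commute : ∀ {ψ} → IsEquivariantMono ψ → ∀ n x → ψ (βsum n x) ≈ βsum n (ψ x)
    βsum-commute ψ-mono zero    x = ε-homo ψ-mono
    βsum-commute ψ-mono (suc n) x =
      trans (homo ψ-mono _ _) (∙-cong (βsum-commute ψ-mono n x) (iter-β-commute ψ-mono n x))

    β-βsum : ∀ n y → β (βsum n y) ∙ y ≈ βsum (suc n) y
    β-βsum zero    y = ∙-congʳ (ε-homo β-mono)
    β-βsum (suc n) y = begin
      β (βsum n y ∙ iter β n y) ∙ y            ≈⟨ ∙-congʳ (homo β-mono _ _) ⟩
      β (βsum n y) ∙ iter β (suc n) y ∙ y      ≈⟨ assoc _ _ _ ⟩
      β (βsum n y) ∙ (iter β (suc n) y ∙ y)    ≈⟨ ∙-congˡ (comm _ _) ⟩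
      β (βsum n y) ∙ (y ∙ iter β (suc n) y)    ≈⟨ assoc _ _ _ ⟨
      β (βsum n y) ∙ y ∙ iter β (suc n) y      ≈⟨ ∙-congʳ (β-βsum n y) ⟩
      βsum (suc n) y ∙ iter β (suc n) y        ∎

    β-fixes-βsum : ∀ n y → iter β n y ≈ y → β (βsum n y) ≈ βsum n y
    β-fixes-βsum n y βⁿy≈y = ∙-cancelʳ y _ _ (trans (β-βsum n y) (∙-congˡ βⁿy≈y))

    faceStep-iter : ∀ n b y → iter (faceStep G α) n (b , y) ≈ᴰ (b ∙ βsum n y , iter β n y)
    faceStep-iter zero    b y = sym (identityʳ b) , refl
    faceStep-iter (suc n) b y with faceStep-iter n b y
    ... | b′≈ , y′≈ = trans (∙-cong b′≈ y′≈) (assoc b (βsum n y) (iter β n y)) ,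
                      trans (fun-cong (⁻¹-cong y′≈)) (⁻¹-homo fun-mono (iter β n y))

    FaceCloses : ℕ → A → Set ℓ
    FaceCloses n y = βsum n y ≈ ε × iter β n y ≈ y

    faceStep-closes⇔ : ∀ n b y → iter (faceStep G α) n (b , y) ≈ᴰ (b , y) ⇔ FaceCloses n y
    faceStep-closes⇔ n b y with faceStep-iter n b y
    ... | b′≈ , y′≈ = mk⇔
      (λ (b′≈b , y′≈y) → identityʳ-unique b _ (trans (sym b′≈) b′≈b) , trans (sym y′≈) y′≈y)
      (λ (sum≈ε , βⁿy≈y) → trans b′≈ (trans (∙-congˡ sum≈ε) (identityʳ b)) , trans y′≈ βⁿy≈y)

    FaceCloses-transport : ∀ {ψ} → IsEquivariantMono ψ → ∀ n {x y} → x ≈ ψ y →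
                           FaceCloses n x ⇔ FaceCloses n y
    FaceCloses-transport {ψ} ψ-mono n {x} {y} x≈ψy = mk⇔
      (λ (sum≈ε , βⁿx≈x) → Equivalence.to ψ≈ε⇔ (trans ψsum≈ sum≈ε) ,
                           injective ψ-mono (trans ψβⁿ≈ (trans βⁿx≈x x≈ψy)))
      (λ (sum≈ε , βⁿy≈y) → trans (sym ψsum≈) (Equivalence.from ψ≈ε⇔ sum≈ε) ,
                           trans (sym ψβⁿ≈) (trans (⟦⟧-cong ψ-mono βⁿy≈y) (sym x≈ψy)))
      where
      ψ≈ε⇔ : ψ (βsum n y) ≈ ε ⇔ βsum n y ≈ ε
      ψ≈ε⇔ = ⟦⟧≈ε⇔≈ε (isMagmaMonomorphism ψ-mono)
      ψsum≈ : ψ (βsum n y) ≈ βsum n x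
      ψsum≈ = trans (βsum-commute ψ-mono n y) (βsum-cong n (sym x≈ψy))
      ψβⁿ≈ : ψ (iter β n y) ≈ iter β n x
      ψβⁿ≈ = trans (iter-β-commute ψ-mono n y) (⟦⟧-cong (iter-mono β-mono n) (sym x≈ψy))

    faceCloses-uniform : ∀ {s a x} → InS G α s x → ∀ n →
      iter (faceStep G α) n (ε , s) ≈ᴰ (ε , s) ⇔ iter (faceStep G α) n (a , x) ≈ᴰ (a , x)
    faceCloses-uniform {s} {a} {x} (i , x≈αⁱs) n =
      ⇔.trans (faceStep-closes⇔ n ε s)
        (⇔.trans (⇔.sym (FaceCloses-transport (powℤ-mono i) n x≈αⁱs))
                 (⇔.sym (faceStep-closes⇔ n a x)))

    faceStep-injective : Injective _≈ᴰ_ _≈ᴰ_ (faceStep G α)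
    faceStep-injective {a , x} {b , y} (ax≈by , fx⁻¹≈fy⁻¹) =
      ∙-cancelʳ x a b (trans ax≈by (∙-congˡ (sym x≈y))) , x≈y
      where
      x≈y : x ≈ y
      x≈y = ⁻¹-injective (fun-injective fx⁻¹≈fy⁻¹)

    zigzag-cong : ∀ n {d d′} → d ≈ᴰ d′ →
                  zigzagL G α d n ≈ᴰ zigzagL G α d′ n × zigzagR G α d n ≈ᴰ zigzagR G α d′ n
    zigzag-cong zero    d≈d′       = d≈d′ , d≈d′
    zigzag-cong (suc n) (b≈ , y≈) =
      proj₂ (zigzag-cong n (∙-cong b≈ y≈ , fun-cong (⁻¹-cong y≈))) ,
      proj₁ (zigzag-cong n (∙-cong b≈ y≈ , inv-cong (⁻¹-cong y≈)))

    shiftL shiftR : A → A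
    shiftL y = y ∙ fun (y ⁻¹)
    shiftR y = y ∙ inv (y ⁻¹)

    zigzagL-iter : ∀ q b y → zigzagL G α (b , y) (q * 2) ≈ᴰ (b ∙ mulℕ G q (shiftL y) , y)
    zigzagL-iter zero    b y = sym (identityʳ b) , refl
    zigzagL-iter (suc q) b y =
      ≈ᴰ-trans moved (≈ᴰ-trans rest (assoc b (shiftL y) _ , refl))
      where
      twoSteps : (b ∙ y ∙ fun (y ⁻¹) , inv (fun (y ⁻¹) ⁻¹)) ≈ᴰ (b ∙ shiftL y , y)
      twoSteps = assoc b y (fun (y ⁻¹)) ,
        trans (inv-cong (sym (⁻¹-homo fun-mono (y ⁻¹)))) (trans (inv-fun _) (⁻¹-involutive y))
      moved = proj₁ (zigzag-cong (q * 2) twoSteps)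
      rest  = zigzagL-iter q (b ∙ shiftL y) y

    zigzagR-iter : ∀ q b y → zigzagR G α (b , y) (q * 2) ≈ᴰ (b ∙ mulℕ G q (shiftR y) , y)
    zigzagR-iter zero    b y = sym (identityʳ b) , refl
    zigzagR-iter (suc q) b y =
      ≈ᴰ-trans moved (≈ᴰ-trans rest (assoc b (shiftR y) _ , refl))
      where
      twoSteps : (b ∙ y ∙ inv (y ⁻¹) , fun (inv (y ⁻¹) ⁻¹)) ≈ᴰ (b ∙ shiftR y , y)
      twoSteps = assoc b y (inv (y ⁻¹)) ,
        trans (⁻¹-homo fun-mono (inv (y ⁻¹))) (trans (⁻¹-cong (fun-inv _)) (⁻¹-involutive y))
      moved = proj₂ (zigzag-cong (q * 2) twoSteps)
      rest  = zigzagR-iter q (b ∙ shiftR y) y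

    shiftL-commute : ∀ {ψ} → IsEquivariantMono ψ → ∀ y → ψ (shiftL y) ≈ shiftL (ψ y)
    shiftL-commute ψ-mono y = trans (homo ψ-mono y _)
      (∙-congˡ (trans (commute ψ-mono (y ⁻¹)) (fun-cong (⁻¹-homo ψ-mono y))))

    shiftR-commute : ∀ {ψ} → IsEquivariantMono ψ → ∀ y → ψ (shiftR y) ≈ shiftR (ψ y)
    shiftR-commute ψ-mono y = trans (homo ψ-mono y _)
      (∙-congˡ (trans (commute-inv ψ-mono (y ⁻¹)) (inv-cong (⁻¹-homo ψ-mono y))))

    shiftL≈inverse : ∀ s → shiftL s ≈ (fun s ∙ s ⁻¹) ⁻¹
    shiftL≈inverse s = sym (trans (⁻¹-anti-homo-∙ (fun s) (s ⁻¹))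
                            (∙-cong (⁻¹-involutive s) (sym (⁻¹-homo fun-mono s))))

    shiftR≈inv : ∀ s → shiftR s ≈ inv (fun s ∙ s ⁻¹)
    shiftR≈inv s = sym (trans (homo inv-mono (fun s) (s ⁻¹)) (∙-congʳ (inv-fun s)))

    zigzagL-closes⇔ : ∀ {s a x} → InS G α s x → ∀ q →
      zigzagL G α (a , x) (q * 2) ≈ᴰ (a , x) ⇔ mulℕ G q (fun s ∙ s ⁻¹) ≈ ε
    zigzagL-closes⇔ {s} {a} {x} (i , x≈αⁱs) q =
      ⇔.trans (translation-closes⇔ (zigzagL-iter q a x))
              (mulℕ≈ε-transport (isMagmaMonomorphism (∘-mono αⁱ ⁻¹-mono)) q shift≈)
      where
      αⁱ = powℤ-mono i
      shift≈ : shiftL x ≈ powℤ G α i ((fun s ∙ s ⁻¹) ⁻¹)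
      shift≈ = trans (∙-cong x≈αⁱs (fun-cong (⁻¹-cong x≈αⁱs)))
                     (trans (sym (shiftL-commute αⁱ s)) (⟦⟧-cong αⁱ (shiftL≈inverse s)))

    zigzagR-closes⇔ : ∀ {s a x} → InS G α s x → ∀ q →
      zigzagR G α (a , x) (q * 2) ≈ᴰ (a , x) ⇔ mulℕ G q (fun s ∙ s ⁻¹) ≈ ε
    zigzagR-closes⇔ {s} {a} {x} (i , x≈αⁱs) q =
      ⇔.trans (translation-closes⇔ (zigzagR-iter q a x))
              (mulℕ≈ε-transport (isMagmaMonomorphism (∘-mono αⁱ inv-mono)) q shift≈)
      where
      αⁱ = powℤ-mono i
      shift≈ : shiftR x ≈ powℤ G α i (inv (fun s ∙ s ⁻¹))
      shift≈ = trans (∙-cong x≈αⁱs (inv-cong (⁻¹-cong x≈αⁱs)))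
                     (trans (sym (shiftR-commute αⁱ s)) (⟦⟧-cong αⁱ (shiftR≈inv s)))

    petrieLength : ∀ W {d e k} → (∀ q → W d (q * 2) ≈ᴰ d ⇔ mulℕ G q e ≈ ε) →
                   ElemOrder G e k → PetrieLength G α W d (k * 2)
    petrieLength W {k = k} closes⇔ (z<s , ke≈ε , below) =
      z<s , divides k ≡.refl , Equivalence.from (closes⇔ k) ke≈ε ,
      λ { j 0<j j<2k (divides q ≡.refl) closes →
            below q (*-cancelʳ-< 2 0 q 0<j) (*-cancelʳ-< 2 q k j<2k)
                    (Equivalence.to (closes⇔ q) closes) }

    β-order : ∀ {s m} → Generates G (InS G α s) → (∀ a → β a ≈ a → a ≈ ε) →
              FaceValency G α (ε , s) m → MapOrder G β m
    β-order {s} {m} generates fixedPointFree valency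
      with LeastPositive-⇔ (λ n → faceStep-closes⇔ n ε s) valency
    ... | 0<m , (_ , βᵐs≈s) , below =
      0<m , fixes-generated (iter-mono β-mono m) generates βᵐ-fixes-S ,
      λ j 0<j j<m βʲ≈id →
        below j 0<j j<m (fixedPointFree _ (β-fixes-βsum j s (βʲ≈id s)) , βʲ≈id s)
      where
      βᵐ-fixes-S : ∀ x → InS G α s x → iter β m x ≈ x
      βᵐ-fixes-S x (i , x≈αⁱs) = begin
        iter β m x                ≈⟨ ⟦⟧-cong (iter-mono β-mono m) x≈αⁱs ⟩
        iter β m (powℤ G α i s)   ≈⟨ iter-β-commute (powℤ-mono i) m s ⟨
        powℤ G α i (iter β m s)   ≈⟨ ⟦⟧-cong (powℤ-mono i) βᵐs≈s ⟩
        powℤ G α i s              ≈⟨ x≈αⁱs ⟨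
        x                         ∎

-- The hypotheses 0 ∉ S and S = −S only make the Cayley graph simple and undirected; the
-- argument does not use them.
lemma3p1 : ∀ {c ℓ} (G : AbelianGroup c ℓ) → Finite G
    → Decidable (AbelianGroup._≈_ G)
    → (α : Automorphism G) → (s : AbelianGroup.Carrier G)
    → let open AbelianGroup G
          open Automorphism α
          S = InS G α s
      in Generates G S
    → ¬ S ε
    → (∀ x → S x → S (x ⁻¹))
    → ∃ λ (m : ℕ) → ∃ λ (l : ℕ) →
        (∀ a x → S x → FaceValency G α (a , x) m)
      × (∀ a x → S x → PetrieLength G α (zigzagL G α) (a , x) l
                      × PetrieLength G α (zigzagR G α) (a , x) l)
      × ((∀ a → (fun a) ⁻¹ ≈ a → a ≈ ε) → MapOrder G (λ a → (fun a) ⁻¹) m)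
      × (∃ λ (k : ℕ) → ElemOrder G (fun s ∙ s ⁻¹) k × l ≡ 2 * k)
lemma3p1 G fin _≟_ α s generates _ _
  with leastPeriod (≈ᴰ-sym G) (faceStep-injective G α) (Finite⇒DartsFinitelyCoded G fin)
                   (≈ᴰ-dec G _≟_) (ε , s)
     | leastPeriod sym (∙-cancelˡ (fun s ∙ s ⁻¹) _ _) (Finite⇒FinitelyCoded G fin) _≟_ ε
  where
  open AbelianGroup G
  open import Algebra.Properties.AbelianGroup G using (∙-cancelˡ)
  open Automorphism α using (fun)
... | m , valency | k , order =
  m , k * 2 ,
  (λ a x x∈S → LeastPositive-⇔ (faceCloses-uniform G α x∈S) valency) ,
  (λ a x x∈S → petrieLength G α (zigzagL G α) (zigzagL-closes⇔ G α x∈S) order ,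
               petrieLength G α (zigzagR G α) (zigzagR-closes⇔ G α x∈S) order) ,
  (λ fixedPointFree → β-order G α generates fixedPointFree valency) ,
  (k , order , *-comm k 2)
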